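{- Let $\mu\subseteq\lambda$ be partitions and $D$ a standard domino tableau of shape $\lambda/\mu$. Then (1) $oh(D)-eh(D)=\tfrac12|\lambda/\mu|-v(\lambda/\mu)$; (2) $ov(D)-ev(D)=\tfrac12|\lambda/\mu|-h(\lambda/\mu)$; (3) $eh(D)+ev(D)=d(\lambda/\mu)$; (4) $v(\lambda/\mu)+h(\lambda/\mu)=\tfrac12|\lambda/\mu|+2\,d(\lambda/\mu)$.
   Context: Partitions are identified with Young diagrams (cell $(i,j)$: row $i$, column $j$); $\lambda/\mu$ is the set of cells of $\lambda$ not in $\mu$ and $|\lambda/\mu|$ its number of cells. $v(\lambda/\mu)$, $h(\lambda/\mu)$, $d(\lambda/\mu)$ are the numbers of cells of $\lambda/\mu$ in even-numbered rows, in even-numbered columns, and in both an even row and an even column. A standard domino tableau (SDT) of shape $\lambda/\mu$ with $2n$ cells is a bijection from the cells to $[2n]$ increasing along rows and columns in which, for each $i$, entries $2i-1,2i$ form a domino (two horizontally or vertically adjacent cells). $oh(D),eh(D)$ are the numbers of horizontal dominoes of $D$ in odd, resp. even, rows; $ov(D),ev(D)$ the numbers of vertical dominoes in odd, resp. even, columns. -}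

module Defs where

open import Data.Bool using (Bool; true; false; not; _∧_; _∨_)
open import Data.Nat using (ℕ; zero; suc; _+_; _*_; _∸_; _≤_; _<_; _≡ᵇ_)
open import Data.List using (List; []; _∷_; length; map; upTo; concatMap; filterᵇ; lookup)
open import Data.List.Relation.Unary.Linked using (Linked)
open import Data.List.Membership.Propositional using (_∈_)
open import Data.Product using (_×_; _,_; proj₁; proj₂; ∃; ∃-syntax)
open import Data.Sum using (_⊎_)
open import Relation.Binary.PropositionalEquality using (_≡_)

-- A partition: a weakly decreasing list of natural numbers (trailing zeros allowed;
-- they contribute no cells).
record Partition : Set where
  constructor mkPartition
  field
    parts   : List ℕ
    weakDec : Linked (λ a b → b ≤ a) parts
open Partition public

-- length of row i (rows are numbered from 1); 0 outside the partition
rowLen : List ℕ → ℕ → ℕ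
rowLen []       _             = 0
rowLen (x ∷ xs) zero          = 0
rowLen (x ∷ xs) (suc zero)    = x
rowLen (x ∷ xs) (suc (suc i)) = rowLen xs (suc i)

_⊆ₚ_ : Partition → Partition → Set
μ ⊆ₚ λ' = ∀ i → rowLen (parts μ) i ≤ rowLen (parts λ') i

-- cells are (row , column), both numbered from 1
Cell : Set
Cell = ℕ × ℕ

-- the numbers a+1, ..., b  (empty if b ≤ a)
interval : ℕ → ℕ → List ℕ
interval a b = map (λ k → suc (a + k)) (upTo (b ∸ a))

skewCells : Partition → Partition → List Cell
skewCells λ' μ =
  concatMap (λ i → map (λ j → (i , j)) (interval (rowLen (parts μ) i) (rowLen (parts λ') i)))
            (interval 0 (length (parts λ')))

isEven : ℕ → Bool
isEven zero    = true
isEven (suc n) = not (isEven n)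

size : Partition → Partition → ℕ
size λ' μ = length (skewCells λ' μ)

vCount : Partition → Partition → ℕ
vCount λ' μ = length (filterᵇ (λ c → isEven (proj₁ c)) (skewCells λ' μ))

hCount : Partition → Partition → ℕ
hCount λ' μ = length (filterᵇ (λ c → isEven (proj₂ c)) (skewCells λ' μ))

dCount : Partition → Partition → ℕ
dCount λ' μ = length (filterᵇ (λ c → isEven (proj₁ c) ∧ isEven (proj₂ c)) (skewCells λ' μ))

Adjacent : Cell → Cell → Set
Adjacent (i , j) (i' , j') =
  (i ≡ i' × (suc j ≡ j' ⊎ suc j' ≡ j)) ⊎ (j ≡ j' × (suc i ≡ i' ⊎ suc i' ≡ i))

record SDT (λ' μ : Partition) : Set where
  field
    n        : ℕ
    T        : Cell → ℕ
    numCells : size λ' μ ≡ 2 * n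
    inRange  : ∀ {c} → c ∈ skewCells λ' μ → 1 ≤ T c × T c ≤ 2 * n
    injective : ∀ {c c'} → c ∈ skewCells λ' μ → c' ∈ skewCells λ' μ → T c ≡ T c' → c ≡ c'
    surjective : ∀ k → 1 ≤ k → k ≤ 2 * n → ∃[ c ] (c ∈ skewCells λ' μ × T c ≡ k)
    rowIncr  : ∀ {i j j'} → (i , j) ∈ skewCells λ' μ → (i , j') ∈ skewCells λ' μ →
               j < j' → T (i , j) < T (i , j')
    colIncr  : ∀ {i i' j} → (i , j) ∈ skewCells λ' μ → (i' , j) ∈ skewCells λ' μ →
               i < i' → T (i , j) < T (i' , j)
    domino   : ∀ k → 1 ≤ k → k ≤ n →
               ∃[ c ] ∃[ c' ] (c ∈ skewCells λ' μ × c' ∈ skewCells λ' μ ×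
                 T c ≡ 2 * k ∸ 1 × T c' ≡ 2 * k × Adjacent c c')
open SDT public

-- the dominoes of D, as pairs (cell labelled 2i-1 , cell labelled 2i)
dominoes : ∀ {λ' μ} → SDT λ' μ → List (Cell × Cell)
dominoes {λ'} {μ} D =
  concatMap (λ c → map (λ c' → (c , c'))
                       (filterᵇ (λ c' → T D c' ≡ᵇ suc (T D c)) (skewCells λ' μ)))
            (filterᵇ (λ c → not (isEven (T D c))) (skewCells λ' μ))

isHorizontal : Cell × Cell → Bool
isHorizontal ((i , _) , (i' , _)) = i ≡ᵇ i'

isVertical : Cell × Cell → Bool
isVertical ((_ , j) , (_ , j')) = j ≡ᵇ j'

oh eh ov ev : ∀ {λ' μ} → SDT λ' μ → ℕ
oh D = length (filterᵇ (λ p → isHorizontal p ∧ not (isEven (proj₁ (proj₁ p)))) (dominoes D))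
eh D = length (filterᵇ (λ p → isHorizontal p ∧ isEven (proj₁ (proj₁ p))) (dominoes D))
ov D = length (filterᵇ (λ p → isVertical p ∧ not (isEven (proj₂ (proj₁ p)))) (dominoes D))
ev D = length (filterᵇ (λ p → isVertical p ∧ isEven (proj₂ (proj₁ p))) (dominoes D))

module Submission where

-- Every cell of λ/μ lies in exactly one domino of D, so any count of cells of
-- λ/μ equals a sum, over the dominoes of D, of the same count restricted to a
-- single domino.  A domino is either horizontal (two cells of one row, in
-- columns of opposite parity) or vertical (two cells of one column, in rows of
-- opposite parity).  Hence for each domino its number of cells, of cells in even
-- rows, in even columns and in both is an explicit combination of the four
-- indicators "horizontal in an odd/even row", "vertical in an odd/even column".
-- Summing over the dominoes gives
--   n = oh + eh + ov + ev,  v = 2eh + ov + ev,  h = 2ev + oh + eh,  d = eh + ev,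
-- from which the four claims follow by linear algebra.

open import Defs
open import Data.Nat using (ℕ; _+_; _*_)
open import Data.Integer using (ℤ; +_; _-_)
open import Data.Product using (_×_)
open import Relation.Binary.PropositionalEquality using (_≡_)

open import Algebra.Properties.CommutativeSemigroup using (interchange)
open import Data.Bool using (Bool; true; false; not; _∧_)
open import Data.Bool.Properties using (not-involutive; not-injective; not-¬; T-≡)
open import Data.Empty using (⊥-elim)
import Data.Integer as ℤ
open import Data.Integer.Properties using (pos-+)
import Data.Integer.Tactic.RingSolver as ℤ-Solver
open import Data.List using (List; []; _∷_; length; map; concatMap; filterᵇ; _++_)
open import Data.List.Membership.Propositional using (_∈_; find; lose)
open import Data.List.Membership.Propositional.Properties
  using (∈-map⁻; ∈-map⁺; ∈-concatMap⁻; ∈-concatMap⁺; ∈-filter⁻; ∈-filter⁺)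
open import Data.List.Membership.Propositional.Properties.WithK using (unique∧set⇒bag)
open import Data.List.Properties using (map-++)
open import Data.List.Relation.Binary.BagAndSetEquality using (∼bag⇒↭)
open import Data.List.Relation.Binary.Permutation.Propositional using (_↭_)
import Data.List.Relation.Binary.Permutation.Propositional.Properties as ↭
open import Data.List.Relation.Unary.All as All using ([]; _∷_)
open import Data.List.Relation.Unary.Any using (here; there)
open import Data.List.Relation.Unary.Unique.Propositional using (Unique; []; _∷_)
import Data.List.Relation.Unary.Unique.Propositional.Properties as Unique
open import Data.Nat using (zero; suc; _≤_; _∸_; _≡ᵇ_; z≤n; s≤s)
open import Data.Nat.ListAction using (sum)
open import Data.Nat.ListAction.Properties using (sum-++; sum-↭)
open import Data.Nat.Properties
  using (+-identityʳ; *-zeroʳ; +-commutativeSemigroup; *-distribˡ-+; *-suc; *-cancelˡ-≤; *-cancelˡ-≡;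
         +-cancelˡ-≡; suc-injective; ≤-trans; n≤1+n; 1+n≢n; m≤n⇒m<n∨m≡n; ≡ᵇ⇒≡; ≡⇒≡ᵇ)
open import Data.Nat.Tactic.RingSolver using (solve-∀)
open import Data.Product using (_,_; proj₁; proj₂; ∃-syntax)
open import Data.Sum using (inj₁; inj₂)
open import Function using (_∘_)
open import Function.Bundles using (mk⇔; Equivalence)
open import Relation.Binary.PropositionalEquality
  using (_≢_; refl; sym; trans; cong; cong₂; subst; subst₂; module ≡-Reasoning)

open ≡-Reasoning

indicator : Bool → ℕ
indicator true  = 1
indicator false = 0

total : {A : Set} → (A → ℕ) → List A → ℕ
total f xs = sum (map f xs)

count-as-total : {A : Set} (p : A → Bool) (xs : List A) →
                 length (filterᵇ p xs) ≡ total (indicator ∘ p) xs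
count-as-total p []       = refl
count-as-total p (x ∷ xs) with p x
... | true  = cong suc (count-as-total p xs)
... | false = count-as-total p xs

length-as-total : {A : Set} (xs : List A) → length xs ≡ total (λ _ → 1) xs
length-as-total []       = refl
length-as-total (x ∷ xs) = cong suc (length-as-total xs)

total-↭ : {A : Set} (f : A → ℕ) {xs ys : List A} → xs ↭ ys → total f xs ≡ total f ys
total-↭ f xs↭ys = sum-↭ (↭.map⁺ f xs↭ys)

total-concatMap : {A B : Set} (f : B → ℕ) (g : A → List B) (xs : List A) →
                  total f (concatMap g xs) ≡ total (λ x → total f (g x)) xs
total-concatMap f g []       = refl
total-concatMap f g (x ∷ xs) = begin
  sum (map f (g x ++ concatMap g xs))         ≡⟨ cong sum (map-++ f (g x) (concatMap g xs)) ⟩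
  sum (map f (g x) ++ map f (concatMap g xs)) ≡⟨ sum-++ (map f (g x)) _ ⟩
  total f (g x) + total f (concatMap g xs)    ≡⟨ cong (_+_ (total f (g x))) (total-concatMap f g xs) ⟩
  total f (g x) + total (λ y → total f (g y)) xs ∎

total-cong : {A : Set} {f g : A → ℕ} (xs : List A) → (∀ {x} → x ∈ xs → f x ≡ g x) →
             total f xs ≡ total g xs
total-cong []       f≗g = refl
total-cong (x ∷ xs) f≗g = cong₂ _+_ (f≗g (here refl)) (total-cong xs (f≗g ∘ there))

total-+ : {A : Set} (f g : A → ℕ) (xs : List A) →
          total (λ x → f x + g x) xs ≡ total f xs + total g xs
total-+ f g []       = refl
total-+ f g (x ∷ xs) = begin
  f x + g x + total (λ y → f y + g y) xs   ≡⟨ cong (_+_ (f x + g x)) (total-+ f g xs) ⟩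
  f x + g x + (total f xs + total g xs)    ≡⟨ interchange +-commutativeSemigroup (f x) (g x) _ _ ⟩
  f x + total f xs + (g x + total g xs)    ∎

total-* : {A : Set} (k : ℕ) (f : A → ℕ) (xs : List A) →
          total (λ x → k * f x) xs ≡ k * total f xs
total-* k f []       = sym (*-zeroʳ k)
total-* k f (x ∷ xs) = begin
  k * f x + total (λ y → k * f y) xs   ≡⟨ cong (_+_ (k * f x)) (total-* k f xs) ⟩
  k * f x + k * total f xs             ≡⟨ sym (*-distribˡ-+ k (f x) (total f xs)) ⟩
  k * (f x + total f xs)               ∎

total-+₃ : {A : Set} (f g h : A → ℕ) (xs : List A) →
           total (λ x → f x + g x + h x) xs ≡ total f xs + total g xs + total h xs
total-+₃ f g h xs = begin
  total (λ x → f x + g x + h x) xs            ≡⟨ total-+ (λ x → f x + g x) h xs ⟩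
  total (λ x → f x + g x) xs + total h xs     ≡⟨ cong (_+ total h xs) (total-+ f g xs) ⟩
  total f xs + total g xs + total h xs        ∎

concatMap-unique : {A B : Set} (f : A → List B) {xs : List A} → Unique xs →
  (∀ {x} → x ∈ xs → Unique (f x)) →
  (∀ {x x' b} → x ∈ xs → x' ∈ xs → b ∈ f x → b ∈ f x' → x ≡ x') →
  Unique (concatMap f xs)
concatMap-unique f []              blocks disjoint = []
concatMap-unique f (x∉xs ∷ unique) blocks disjoint =
  Unique.++⁺ (blocks (here refl))
             (concatMap-unique f unique (blocks ∘ there) (λ m m' → disjoint (there m) (there m')))
             λ (b∈fx , b∈rest) →
               let x' , x'∈xs , b∈fx' = find (∈-concatMap⁻ f {xs = _} b∈rest)
               in All.lookup x∉xs x'∈xs (disjoint (here refl) (there x'∈xs) b∈fx b∈fx')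

tagged : {A B : Set} → (A → List B) → List A → List (A × B)
tagged g xs = concatMap (λ x → map (λ y → (x , y)) (g x)) xs

tag-first : {A B : Set} {x : A} {ys : List B} {p : A × B} →
            p ∈ map (λ y → (x , y)) ys → proj₁ p ≡ x
tag-first m with ∈-map⁻ _ m
... | _ , _ , refl = refl

tagged-∈⁻ : {A B : Set} {g : A → List B} {xs : List A} {x : A} {y : B} →
            (x , y) ∈ tagged g xs → x ∈ xs × y ∈ g x
tagged-∈⁻ {g = g} m with find (∈-concatMap⁻ (λ x → map (λ y → (x , y)) (g x)) m)
... | x , x∈xs , xy∈ with ∈-map⁻ _ xy∈
...   | y , y∈gx , refl = x∈xs , y∈gx

tagged-∈⁺ : {A B : Set} {g : A → List B} {xs : List A} {x : A} {y : B} →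
            x ∈ xs → y ∈ g x → (x , y) ∈ tagged g xs
tagged-∈⁺ {g = g} {x = x} x∈xs y∈gx =
  ∈-concatMap⁺ (λ x → map (λ y → (x , y)) (g x)) (lose x∈xs (∈-map⁺ (λ y → (x , y)) y∈gx))

tagged-unique : {A B : Set} (g : A → List B) {xs : List A} → Unique xs →
                (∀ x → Unique (g x)) → Unique (tagged g xs)
tagged-unique g unique blocks =
  concatMap-unique _ unique (λ {x} _ → Unique.map⁺ (cong proj₂) (blocks x))
                   (λ _ _ m m' → trans (sym (tag-first m)) (tag-first m'))

interval-unique : (a b : ℕ) → Unique (interval a b)
interval-unique a b = Unique.map⁺ (λ e → +-cancelˡ-≡ a _ _ (suc-injective e)) (Unique.upTo⁺ _)

skewCells-unique : (λ' μ : Partition) → Unique (skewCells λ' μ)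
skewCells-unique λ' μ =
  tagged-unique (λ i → interval (rowLen (parts μ) i) (rowLen (parts λ') i))
                (interval-unique 0 (length (parts λ')))
                (λ i → interval-unique (rowLen (parts μ) i) (rowLen (parts λ') i))

isEven-suc-suc : (m : ℕ) → isEven (suc (suc m)) ≡ isEven m
isEven-suc-suc m = not-involutive (isEven m)

isEven-double : (k : ℕ) → isEven (2 * k) ≡ true
isEven-double zero    = refl
isEven-double (suc k) = begin
  isEven (2 * suc k)         ≡⟨ cong isEven (*-suc 2 k) ⟩
  isEven (suc (suc (2 * k))) ≡⟨ isEven-suc-suc (2 * k) ⟩
  isEven (2 * k)             ≡⟨ isEven-double k ⟩
  true                       ∎

even⇒double : (m : ℕ) → isEven m ≡ true → ∃[ k ] m ≡ 2 * k
even⇒double zero          _    = 0 , refl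
even⇒double (suc (suc m)) even with even⇒double m (trans (sym (isEven-suc-suc m)) even)
... | k , refl = suc k , sym (*-suc 2 k)

odd-below-double : {m n : ℕ} → isEven m ≡ false → m ≤ 2 * n → suc m ≤ 2 * n
odd-below-double {m} {n} odd m≤2n with m≤n⇒m<n∨m≡n m≤2n
... | inj₁ m<2n = m<2n
... | inj₂ refl with () ← trans (sym (isEven-double n)) odd

even-predecessor : (t : ℕ) → 1 ≤ t → isEven t ≡ true →
                   ∃[ m ] (suc m ≡ t × 1 ≤ m × isEven m ≡ false)
even-predecessor (suc (suc m)) _ even =
  suc m , refl , s≤s z≤n , cong not (trans (sym (isEven-suc-suc m)) even)

-- A duplicate-free list L, labelled bijectively by 1, …, 2n, is the disjoint union
-- of the pairs (c , c') with lab c odd and lab c' = lab c + 1; so a sum over L is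
-- a sum over these pairs.  For a standard domino tableau these pairs are its dominoes.
module ConsecutivePairs {A : Set} (L : List A) (uniqueL : Unique L) (lab : A → ℕ) (n : ℕ)
  (inRange    : ∀ {c} → c ∈ L → 1 ≤ lab c × lab c ≤ 2 * n)
  (injective  : ∀ {c c'} → c ∈ L → c' ∈ L → lab c ≡ lab c' → c ≡ c')
  (surjective : ∀ k → 1 ≤ k → k ≤ 2 * n → ∃[ c ] (c ∈ L × lab c ≡ k))
  where

  successors : A → List A
  successors c = filterᵇ (λ c' → lab c' ≡ᵇ suc (lab c)) L

  oddCells : List A
  oddCells = filterᵇ (λ c → not (isEven (lab c))) L

  pairs : List (A × A)
  pairs = tagged successors oddCells

  record IsPair (c c' : A) : Set where
    field
      first∈  : c ∈ L
      second∈ : c' ∈ L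
      odd     : isEven (lab c) ≡ false
      next    : lab c' ≡ suc (lab c)
  open IsPair public

  pair⁻ : ∀ {c c'} → (c , c') ∈ pairs → IsPair c c'
  pair⁻ m with tagged-∈⁻ {g = successors} m
  ... | c∈odd , c'∈succ with ∈-filter⁻ _ c∈odd | ∈-filter⁻ _ c'∈succ
  ...   | c∈ , odd | c'∈ , next = record
    { first∈ = c∈ ; second∈ = c'∈
    ; odd    = not-injective (Equivalence.to T-≡ odd)
    ; next   = ≡ᵇ⇒≡ _ _ next }

  pair⁺ : ∀ {c c'} → IsPair c c' → (c , c') ∈ pairs
  pair⁺ p = tagged-∈⁺ {g = successors}
    (∈-filter⁺ _ (first∈ p) (Equivalence.from T-≡ (cong not (odd p))))
    (∈-filter⁺ _ (second∈ p) (≡⇒≡ᵇ _ _ (next p)))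

  second-even : ∀ {c c'} → IsPair c c' → isEven (lab c') ≡ true
  second-even p = trans (cong isEven (next p)) (cong not (odd p))

  pair-labels : ∀ {c c'} → IsPair c c' →
                ∃[ k ] (1 ≤ k × k ≤ n × lab c ≡ 2 * k ∸ 1 × lab c' ≡ 2 * k)
  pair-labels {c} {c'} p with even⇒double (lab c') (second-even p)
  ... | zero  , lab≡0 with () ← trans (sym (next p)) lab≡0
  ... | suc k , lab≡2k =
    suc k , s≤s z≤n
          , *-cancelˡ-≤ 2 (subst (_≤ 2 * n) lab≡2k (proj₂ (inRange (second∈ p))))
          , cong (_∸ 1) (trans (sym (next p)) lab≡2k)
          , lab≡2k

  cellsOf : A × A → List A
  cellsOf (c , c') = c ∷ c' ∷ []

  covering : List A
  covering = concatMap cellsOf pairs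

  pairs-disjoint : ∀ {p q x} → p ∈ pairs → q ∈ pairs → x ∈ cellsOf p → x ∈ cellsOf q → p ≡ q
  pairs-disjoint {c , c'} {d , d'} mp mq (here refl) (here refl) =
    cong (c ,_) (injective (second∈ (pair⁻ mp)) (second∈ (pair⁻ mq))
                           (trans (next (pair⁻ mp)) (sym (next (pair⁻ mq)))))
  pairs-disjoint {c , c'} {d , d'} mp mq (there (here refl)) (there (here refl)) =
    cong (_, c') (injective (first∈ (pair⁻ mp)) (first∈ (pair⁻ mq))
                            (suc-injective (trans (sym (next (pair⁻ mp))) (next (pair⁻ mq)))))
  pairs-disjoint mp mq (here refl) (there (here refl))
    with () ← trans (sym (second-even (pair⁻ mq))) (odd (pair⁻ mp))
  pairs-disjoint mp mq (there (here refl)) (here refl)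
    with () ← trans (sym (second-even (pair⁻ mp))) (odd (pair⁻ mq))

  pair-distinct : ∀ {p} → p ∈ pairs → Unique (cellsOf p)
  pair-distinct m = ((λ c≡c' → 1+n≢n (trans (sym (next (pair⁻ m))) (cong lab (sym c≡c')))) ∷ []) ∷ [] ∷ []

  covering-unique : Unique covering
  covering-unique = concatMap-unique cellsOf
    (tagged-unique successors (Unique.filter⁺ _ uniqueL) (λ _ → Unique.filter⁺ _ uniqueL))
    pair-distinct pairs-disjoint

  covering⊆L : ∀ {x} → x ∈ covering → x ∈ L
  covering⊆L m with find (∈-concatMap⁻ cellsOf {xs = pairs} m)
  ... | (c , c') , m' , here refl         = first∈ (pair⁻ m')
  ... | (c , c') , m' , there (here refl) = second∈ (pair⁻ m')

  -- every cell lies in a pair: with its successor if its label is odd,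
  -- with its predecessor if its label is even
  L⊆covering : ∀ {x} → x ∈ L → x ∈ covering
  L⊆covering {x} x∈ with isEven (lab x) in parity
  ... | false =
    let c' , c'∈ , lab≡ = surjective (suc (lab x)) (s≤s z≤n)
                            (odd-below-double {n = n} parity (proj₂ (inRange x∈)))
    in ∈-concatMap⁺ cellsOf (lose (pair⁺ (record { first∈ = x∈ ; second∈ = c'∈
                                                 ; odd = parity ; next = lab≡ }))
                                  (here refl))
  ... | true =
    let m , suc-m≡t , 1≤m , m-odd = even-predecessor (lab x) (proj₁ (inRange x∈)) parity
        c , c∈ , lab≡ = surjective m 1≤m
                          (≤-trans (n≤1+n m) (subst (_≤ 2 * n) (sym suc-m≡t) (proj₂ (inRange x∈))))
    in ∈-concatMap⁺ cellsOf (lose (pair⁺ (record { first∈ = c∈ ; second∈ = x∈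
                                                 ; odd = trans (cong isEven lab≡) m-odd
                                                 ; next = trans (sym suc-m≡t) (cong suc (sym lab≡)) }))
                                  (there (here refl)))

  covering-↭ : covering ↭ L
  covering-↭ = ∼bag⇒↭ (unique∧set⇒bag covering-unique uniqueL (mk⇔ covering⊆L L⊆covering))

  total-by-pairs : (f : A → ℕ) → total f L ≡ total (λ p → f (proj₁ p) + f (proj₂ p)) pairs
  total-by-pairs f = begin
    total f L                                     ≡⟨ total-↭ f covering-↭ ⟨
    total f covering                              ≡⟨ total-concatMap f cellsOf pairs ⟩
    total (λ p → total f (cellsOf p)) pairs       ≡⟨ total-cong pairs (λ {p} _ →
                                                       cong (_+_ (f (proj₁ p))) (+-identityʳ (f (proj₂ p)))) ⟩
    total (λ p → f (proj₁ p) + f (proj₂ p)) pairs ∎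

≡ᵇ-true : {m n : ℕ} → m ≡ n → (m ≡ᵇ n) ≡ true
≡ᵇ-true {m} {n} m≡n = Equivalence.to T-≡ (≡⇒≡ᵇ m n m≡n)

≡ᵇ-false : {m n : ℕ} → m ≢ n → (m ≡ᵇ n) ≡ false
≡ᵇ-false {m} {n} m≢n with m ≡ᵇ n in eq
... | true  = ⊥-elim (m≢n (≡ᵇ⇒≡ m n (Equivalence.from T-≡ eq)))
... | false = refl

-- The identities, for one domino, between the parities of the rows (r , r') and
-- columns (s , s') of its two cells and its orientation (hor , ver): its cells in
-- even rows, in even columns, in both, and all its cells, expressed through the
-- indicators of "horizontal in an odd/even row" and "vertical in an odd/even column".
record DominoIdentities (hor ver r s r' s' : Bool) : Set where
  constructor holds
  field
    evenRows : indicator r + indicator r'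
             ≡ 2 * indicator (hor ∧ r) + indicator (ver ∧ not s) + indicator (ver ∧ s)
    evenCols : indicator s + indicator s'
             ≡ 2 * indicator (ver ∧ s) + indicator (hor ∧ not r) + indicator (hor ∧ r)
    evenBoth : indicator (r ∧ s) + indicator (r' ∧ s')
             ≡ indicator (hor ∧ r) + indicator (ver ∧ s)
    cells    : 1 + 1
             ≡ 2 * (indicator (hor ∧ not r) + indicator (hor ∧ r)
                    + indicator (ver ∧ not s) + indicator (ver ∧ s))

horizontal-identities : (r s s' : Bool) → s ≢ s' → DominoIdentities true false r s r s'
horizontal-identities true  true  false _ = holds refl refl refl refl
horizontal-identities true  false true  _ = holds refl refl refl refl
horizontal-identities false true  false _ = holds refl refl refl refl
horizontal-identities false false true  _ = holds refl refl refl refl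
horizontal-identities _     true  true  s≢s' = ⊥-elim (s≢s' refl)
horizontal-identities _     false false s≢s' = ⊥-elim (s≢s' refl)

vertical-identities : (r r' s : Bool) → r ≢ r' → DominoIdentities false true r s r' s
vertical-identities true  false true  _ = holds refl refl refl refl
vertical-identities true  false false _ = holds refl refl refl refl
vertical-identities false true  true  _ = holds refl refl refl refl
vertical-identities false true  false _ = holds refl refl refl refl
vertical-identities true  true  _ r≢r' = ⊥-elim (r≢r' refl)
vertical-identities false false _ r≢r' = ⊥-elim (r≢r' refl)

parity-flips : (m : ℕ) → isEven m ≢ isEven (suc m)
parity-flips m = not-¬ refl

domino-identities : (c c' : Cell) → Adjacent c c' →
  DominoIdentities (isHorizontal (c , c')) (isVertical (c , c'))
                   (isEven (proj₁ c)) (isEven (proj₂ c)) (isEven (proj₁ c')) (isEven (proj₂ c'))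
domino-identities (i , j) (.i , .(suc j)) (inj₁ (refl , inj₁ refl))
  rewrite ≡ᵇ-true {i} refl | ≡ᵇ-false (1+n≢n ∘ sym {x = j}) =
  horizontal-identities _ _ _ (parity-flips j)
domino-identities (i , .(suc j)) (.i , j) (inj₁ (refl , inj₂ refl))
  rewrite ≡ᵇ-true {i} refl | ≡ᵇ-false (1+n≢n {j}) =
  horizontal-identities _ _ _ (parity-flips j ∘ sym)
domino-identities (i , j) (.(suc i) , .j) (inj₂ (refl , inj₁ refl))
  rewrite ≡ᵇ-false (1+n≢n ∘ sym {x = i}) | ≡ᵇ-true {j} refl =
  vertical-identities _ _ _ (parity-flips i)
domino-identities (.(suc i) , j) (i , .j) (inj₂ (refl , inj₂ refl))
  rewrite ≡ᵇ-false (1+n≢n {i}) | ≡ᵇ-true {j} refl =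
  vertical-identities _ _ _ (parity-flips i ∘ sym)

hOdd hEven vOdd vEven : Cell × Cell → ℕ
hOdd  p = indicator (isHorizontal p ∧ not (isEven (proj₁ (proj₁ p))))
hEven p = indicator (isHorizontal p ∧ isEven (proj₁ (proj₁ p)))
vOdd  p = indicator (isVertical p ∧ not (isEven (proj₂ (proj₁ p))))
vEven p = indicator (isVertical p ∧ isEven (proj₂ (proj₁ p)))

module DominoCounts (λ' μ : Partition) (D : SDT λ' μ) where
  open ConsecutivePairs (skewCells λ' μ) (skewCells-unique λ' μ) (T D) (n D)
                        (inRange D) (injective D) (surjective D)

  -- the dominoes of D are the pairs labelled (2k-1 , 2k), which are adjacent cells
  dominoes-adjacent : ∀ {c c'} → (c , c') ∈ dominoes D → Adjacent c c'
  dominoes-adjacent m with pair⁻ m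
  ... | p with pair-labels p
  ...   | k , 1≤k , k≤n , lab-c , lab-c' with domino D k 1≤k k≤n
  ...     | e , e' , e∈ , e'∈ , lab-e , lab-e' , e~e' =
    subst₂ Adjacent (injective D e∈ (first∈ p) (trans lab-e (sym lab-c)))
                    (injective D e'∈ (second∈ p) (trans lab-e' (sym lab-c'))) e~e'

  identities : ∀ {c c'} → (c , c') ∈ dominoes D →
    DominoIdentities (isHorizontal (c , c')) (isVertical (c , c'))
                     (isEven (proj₁ c)) (isEven (proj₂ c)) (isEven (proj₁ c')) (isEven (proj₂ c'))
  identities m = domino-identities _ _ (dominoes-adjacent m)
  open DominoIdentities

  count-by-dominoes : (P : Cell → Bool) (g : Cell × Cell → ℕ) →
    (∀ {c c'} → (c , c') ∈ dominoes D → indicator (P c) + indicator (P c') ≡ g (c , c')) →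
    length (filterᵇ P (skewCells λ' μ)) ≡ total g (dominoes D)
  count-by-dominoes P g local = begin
    length (filterᵇ P (skewCells λ' μ))  ≡⟨ count-as-total P (skewCells λ' μ) ⟩
    total (indicator ∘ P) (skewCells λ' μ) ≡⟨ total-by-pairs (indicator ∘ P) ⟩
    total (λ p → indicator (P (proj₁ p)) + indicator (P (proj₂ p))) (dominoes D)
      ≡⟨ total-cong (dominoes D) local ⟩
    total g (dominoes D) ∎

  oh≡ : oh D ≡ total hOdd (dominoes D)
  oh≡ = count-as-total _ (dominoes D)
  eh≡ : eh D ≡ total hEven (dominoes D)
  eh≡ = count-as-total _ (dominoes D)
  ov≡ : ov D ≡ total vOdd (dominoes D)
  ov≡ = count-as-total _ (dominoes D)
  ev≡ : ev D ≡ total vEven (dominoes D)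
  ev≡ = count-as-total _ (dominoes D)

  v-count : vCount λ' μ ≡ 2 * eh D + ov D + ev D
  v-count = begin
    vCount λ' μ
      ≡⟨ count-by-dominoes (λ c → isEven (proj₁ c)) (λ p → 2 * hEven p + vOdd p + vEven p)
                           (λ m → evenRows (identities m)) ⟩
    total (λ p → 2 * hEven p + vOdd p + vEven p) (dominoes D)
      ≡⟨ total-+₃ (λ p → 2 * hEven p) vOdd vEven (dominoes D) ⟩
    total (λ p → 2 * hEven p) (dominoes D) + total vOdd (dominoes D) + total vEven (dominoes D)
      ≡⟨ cong₂ _+_ (cong₂ _+_ (trans (total-* 2 hEven (dominoes D)) (cong (2 *_) (sym eh≡)))
                              (sym ov≡))
                   (sym ev≡) ⟩
    2 * eh D + ov D + ev D ∎

  h-count : hCount λ' μ ≡ 2 * ev D + oh D + eh D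
  h-count = begin
    hCount λ' μ
      ≡⟨ count-by-dominoes (λ c → isEven (proj₂ c)) (λ p → 2 * vEven p + hOdd p + hEven p)
                           (λ m → evenCols (identities m)) ⟩
    total (λ p → 2 * vEven p + hOdd p + hEven p) (dominoes D)
      ≡⟨ total-+₃ (λ p → 2 * vEven p) hOdd hEven (dominoes D) ⟩
    total (λ p → 2 * vEven p) (dominoes D) + total hOdd (dominoes D) + total hEven (dominoes D)
      ≡⟨ cong₂ _+_ (cong₂ _+_ (trans (total-* 2 vEven (dominoes D)) (cong (2 *_) (sym ev≡)))
                              (sym oh≡))
                   (sym eh≡) ⟩
    2 * ev D + oh D + eh D ∎

  d-count : dCount λ' μ ≡ eh D + ev D
  d-count = begin
    dCount λ' μ
      ≡⟨ count-by-dominoes (λ c → isEven (proj₁ c) ∧ isEven (proj₂ c)) (λ p → hEven p + vEven p)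
                           (λ m → evenBoth (identities m)) ⟩
    total (λ p → hEven p + vEven p) (dominoes D)
      ≡⟨ total-+ hEven vEven (dominoes D) ⟩
    total hEven (dominoes D) + total vEven (dominoes D)
      ≡⟨ cong₂ _+_ (sym eh≡) (sym ev≡) ⟩
    eh D + ev D ∎

  -- |λ/μ| = 2(oh + eh + ov + ev), and |λ/μ| = 2n
  n-count : n D ≡ oh D + eh D + ov D + ev D
  n-count = *-cancelˡ-≡ (n D) (oh D + eh D + ov D + ev D) 2 (begin
    2 * n D                                ≡⟨ numCells D ⟨
    length (skewCells λ' μ)                ≡⟨ length-as-total (skewCells λ' μ) ⟩
    total (λ _ → 1) (skewCells λ' μ)       ≡⟨ total-by-pairs (λ _ → 1) ⟩
    total (λ _ → 1 + 1) (dominoes D)       ≡⟨ total-cong (dominoes D) (λ m → cells (identities m)) ⟩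
    total (λ p → 2 * kind p) (dominoes D)  ≡⟨ total-* 2 kind (dominoes D) ⟩
    2 * total kind (dominoes D)            ≡⟨ cong (2 *_) kinds ⟩
    2 * (oh D + eh D + ov D + ev D)        ∎)
    where
    kind : Cell × Cell → ℕ
    kind p = hOdd p + hEven p + vOdd p + vEven p
    kinds : total kind (dominoes D) ≡ oh D + eh D + ov D + ev D
    kinds = begin
      total kind (dominoes D)
        ≡⟨ total-+₃ (λ p → hOdd p + hEven p) vOdd vEven (dominoes D) ⟩
      total (λ p → hOdd p + hEven p) (dominoes D) + total vOdd (dominoes D) + total vEven (dominoes D)
        ≡⟨ cong₂ _+_ (cong₂ _+_ (trans (total-+ hOdd hEven (dominoes D)) (sym (cong₂ _+_ oh≡ eh≡)))
                                (sym ov≡))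
                     (sym ev≡) ⟩
      oh D + eh D + ov D + ev D ∎

difference-shift : (x y k : ℕ) → (+ x) - (+ y) ≡ (+ (x + k)) - (+ (y + k))
difference-shift x y k rewrite pos-+ x k | pos-+ y k = shift (+ x) (+ y) (+ k)
  where
  shift : (X Y K : ℤ) → X - Y ≡ (X ℤ.+ K) - (Y ℤ.+ K)
  shift = ℤ-Solver.solve-∀

linear-consequences : (a b c d : ℕ) {n v h e : ℕ} →
  n ≡ a + b + c + d → v ≡ 2 * b + c + d → h ≡ 2 * d + a + b → e ≡ b + d →
  ((+ a) - (+ b) ≡ (+ n) - (+ v)) × ((+ c) - (+ d) ≡ (+ n) - (+ h))
  × (b + d ≡ e) × (v + h ≡ n + 2 * e)
linear-consequences a b c d refl refl refl refl =
    trans (difference-shift a b (b + c + d)) (cong₂ (λ x y → (+ x) - (+ y)) (n₁ a b c d) (v₁ b c d))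
  , trans (difference-shift c d (a + b + d)) (cong₂ (λ x y → (+ x) - (+ y)) (n₂ a b c d) (h₂ a b d))
  , refl
  , vh a b c d
  where
  n₁ : ∀ a b c d → a + (b + c + d) ≡ a + b + c + d
  n₁ = solve-∀
  v₁ : ∀ b c d → b + (b + c + d) ≡ 2 * b + c + d
  v₁ = solve-∀
  n₂ : ∀ a b c d → c + (a + b + d) ≡ a + b + c + d
  n₂ = solve-∀
  h₂ : ∀ a b d → d + (a + b + d) ≡ 2 * d + a + b
  h₂ = solve-∀
  vh : ∀ a b c d → 2 * b + c + d + (2 * d + a + b) ≡ a + b + c + d + 2 * (b + d)
  vh = solve-∀

lemma2p1 : (λ' μ : Partition) → μ ⊆ₚ λ' → (D : SDT λ' μ) →
    ((+ oh D) - (+ eh D) ≡ (+ n D) - (+ vCount λ' μ))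
    × ((+ ov D) - (+ ev D) ≡ (+ n D) - (+ hCount λ' μ))
    × (eh D + ev D ≡ dCount λ' μ)
    × (vCount λ' μ + hCount λ' μ ≡ n D + 2 * dCount λ' μ)
lemma2p1 λ' μ _ D = linear-consequences (oh D) (eh D) (ov D) (ev D) n-count v-count h-count d-count
  where open DominoCounts λ' μ D
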